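{- Let $Q$ be a delta operator with basic sequence $(\phi_n)_{n\in\mathbb N}$ and let $Q^{ -1}$ be its sigma operator. Then for all positive integers $n,p$, \[ (n+1)(n+2)\cdots(n+p)\,Q^{ -p}\phi_n(x)=\phi_{n+p}(x), \] where $Q^{ -p}\defeq(Q^{ -1})^p$. In particular $\phi_n(x)=n!\,Q^{ -n}1$.
   Context: $\mathbb K$ is a field of characteristic zero; operators are linear maps on $\mathbb K[x]$. A delta operator is an operator $Q$ commuting with all shifts $f(x)\mapsto f(x+a)$ with $Qx$ a nonzero constant. Its basic sequence is the unique polynomial sequence with $\deg\phi_n=n$, $\phi_0=1$, $\phi_n(0)=0$ ($n\ge1$), $Q\phi_n=n\phi_{n-1}$. The sigma operator $Q^{ -1}$ is the unique linear operator with $QQ^{ -1}=1$ and $Q^{ -1}Q=1-\mathcal E$, where $\mathcal Ef=f(0)$ (a constant polynomial). -}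

module Defs where

open import Level using (Level; _⊔_)
open import Algebra.Bundles using (CommutativeRing)
open import Data.Nat as ℕ using (ℕ; zero; suc; _<_; _≤_)
open import Data.List using (List; []; _∷_; map)
open import Data.Product using (Σ; _×_; ∃)
open import Relation.Nullary using (¬_)

record Field (c ℓ : Level) : Set (Level.suc (c ⊔ ℓ)) where
  field
    commutativeRing : CommutativeRing c ℓ
  open CommutativeRing commutativeRing public
  field
    1≉0     : ¬ (1# ≈ 0#)
    inverse : ∀ x → ¬ (x ≈ 0#) → Σ Carrier (λ y → x * y ≈ 1#)

module _ {c ℓ : Level} (F : Field c ℓ) where
  open Field F

  fromℕ : ℕ → Carrier
  fromℕ zero    = 0#
  fromℕ (suc n) = 1# + fromℕ n

  CharZero : Set ℓ
  CharZero = ∀ n → ¬ (fromℕ (suc n) ≈ 0#)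

  -- Polynomials in K[x] as coefficient lists (constant term first);
  -- equality is coefficientwise, missing coefficients being 0.
  Poly : Set c
  Poly = List Carrier

  coeff : Poly → ℕ → Carrier
  coeff []      k       = 0#
  coeff (a ∷ p) zero    = a
  coeff (a ∷ p) (suc k) = coeff p k

  _≈P_ : Poly → Poly → Set ℓ
  p ≈P q = ∀ k → coeff p k ≈ coeff q k

  _⊕_ : Poly → Poly → Poly
  []      ⊕ q       = q
  (a ∷ p) ⊕ []      = a ∷ p
  (a ∷ p) ⊕ (b ∷ q) = (a + b) ∷ (p ⊕ q)

  _·_ : Carrier → Poly → Poly
  a · p = map (a *_) p

  ⊖_ : Poly → Poly
  ⊖ p = map -_ p

  const : Carrier → Poly
  const a = a ∷ []

  onePoly : Poly
  onePoly = const 1#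

  X : Poly
  X = 0# ∷ 1# ∷ []

  mulX : Poly → Poly
  mulX p = 0# ∷ p

  -- shift f(x) ↦ f(x + a), by Horner: f = c + x g  ⇒  f(x+a) = c + (x + a) g(x+a)
  shift : Carrier → Poly → Poly
  shift a []      = []
  shift a (b ∷ p) = const b ⊕ (mulX (shift a p) ⊕ (a · shift a p))

  𝓔 : Poly → Poly
  𝓔 p = const (coeff p 0)

  HasDegree : Poly → ℕ → Set ℓ
  HasDegree p n = ¬ (coeff p n ≈ 0#) × (∀ k → n < k → coeff p k ≈ 0#)

  Op : Set c
  Op = Poly → Poly

  record IsLinear (T : Op) : Set (c ⊔ ℓ) where
    field
      cong     : ∀ {p q} → p ≈P q → T p ≈P T q
      additive : ∀ p q → T (p ⊕ q) ≈P (T p ⊕ T q)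
      homog    : ∀ a p → T (a · p) ≈P (a · T p)

  _^_ : Op → ℕ → Op
  (T ^ zero)  p = p
  (T ^ suc n) p = T ((T ^ n) p)

  record IsDelta (Q : Op) : Set (c ⊔ ℓ) where
    field
      linear     : IsLinear Q
      shiftInv   : ∀ a p → Q (shift a p) ≈P shift a (Q p)
      onX        : Σ Carrier (λ k → ¬ (k ≈ 0#) × (Q X ≈P const k))

  record IsBasicSequence (Q : Op) (φ : ℕ → Poly) : Set (c ⊔ ℓ) where
    field
      degree  : ∀ n → HasDegree (φ n) n
      zeroth  : φ 0 ≈P onePoly
      atZero  : ∀ n → coeff (φ (suc n)) 0 ≈ 0#
      lowers  : ∀ n → Q (φ (suc n)) ≈P (fromℕ (suc n) · φ n)

  record IsSigma (Q S : Op) : Set (c ⊔ ℓ) where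
    field
      linear : IsLinear S
      rightInv : ∀ p → Q (S p) ≈P p
      leftInv  : ∀ p → S (Q p) ≈P (p ⊕ (⊖ 𝓔 p))

  risingFrom : ℕ → ℕ → ℕ
  risingFrom n zero    = 1
  risingFrom n (suc p) = risingFrom n p ℕ.* (n ℕ.+ suc p)

{-# OPTIONS --safe #-}
-- Applying the sigma operator S to Q φₙ₊₁ = (n+1) φₙ gives (n+1) S φₙ = φₙ₊₁ − φₙ₊₁(0) = φₙ₊₁,
-- because S Q = 1 − 𝓔 and φₙ₊₁(0) = 0. Iterating p times yields the formula, and starting
-- from φ₀ = 1 gives φₙ = n! Sⁿ 1. Nothing else is used: neither the delta property of Q,
-- nor characteristic zero, nor Q S = 1.
module Submission where

open import Defs
open import Level using (Level)
open import Data.Nat as ℕ using (ℕ; zero; suc; _+_; _!)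
import Data.Nat.Properties as ℕ
open import Data.Product using (_×_; _,_)
open import Data.List using ([]; _∷_)
open import Relation.Binary.PropositionalEquality as ≡ using (_≡_)
open import Relation.Binary.Bundles using (Setoid)
import Relation.Binary.Construct.On as On
open import Relation.Binary.Indexed.Heterogeneous.Construct.Trivial using (indexedSetoid)
open import Function.Indexed.Relation.Binary.Equality using (≡-setoid)
import Algebra.Properties.Ring as RingProperties
import Algebra.Properties.Semiring.Mult as SemiringMult
import Relation.Binary.Reasoning.Setoid as SetoidReasoning

module Polynomials {c ℓ : Level} (F : Field c ℓ) where
  open Field F renaming (_+_ to _+ᴷ_) hiding (zero)
  open RingProperties ring using (-0#≈0#)
  open SemiringMult semiring renaming (_×_ to _×ᴷ_) using (×1-homo-*)

  infix 4 _≈ₚ_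
  infixl 6 _⊕ₚ_
  infixr 7 _·ₚ_
  infix 8 ⊖ₚ_

  -- _≈ₚ_ unfolds to a pointwise statement about coeff, so Agda cannot infer its endpoints;
  -- this is why congruence lemmas below are often given their implicit polynomials.
  _≈ₚ_ : Poly F → Poly F → Set ℓ
  _≈ₚ_ = _≈P_ F

  _⊕ₚ_ : Poly F → Poly F → Poly F
  _⊕ₚ_ = _⊕_ F

  _·ₚ_ : Carrier → Poly F → Poly F
  _·ₚ_ = _·_ F

  ⊖ₚ_ : Poly F → Poly F
  ⊖ₚ_ = ⊖_ F

  ≈ₚ-setoid : Setoid c ℓ
  ≈ₚ-setoid = On.setoid (≡-setoid ℕ (indexedSetoid setoid)) (coeff F)

  coeff-⊕ : ∀ p q k → coeff F (p ⊕ₚ q) k ≈ coeff F p k +ᴷ coeff F q k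
  coeff-⊕ []      q       k       = sym (+-identityˡ _)
  coeff-⊕ (a ∷ p) []      k       = sym (+-identityʳ _)
  coeff-⊕ (a ∷ p) (b ∷ q) zero    = refl
  coeff-⊕ (a ∷ p) (b ∷ q) (suc k) = coeff-⊕ p q k

  coeff-· : ∀ a p k → coeff F (a ·ₚ p) k ≈ a * coeff F p k
  coeff-· a []      k       = sym (zeroʳ a)
  coeff-· a (b ∷ p) zero    = refl
  coeff-· a (b ∷ p) (suc k) = coeff-· a p k

  coeff-⊖ : ∀ p k → coeff F (⊖ₚ p) k ≈ - coeff F p k
  coeff-⊖ []      k       = sym -0#≈0#
  coeff-⊖ (b ∷ p) zero    = refl
  coeff-⊖ (b ∷ p) (suc k) = coeff-⊖ p k

  ·-congˡ : ∀ a {p q} → p ≈ₚ q → a ·ₚ p ≈ₚ a ·ₚ q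
  ·-congˡ a {p} {q} p≈q k = begin
    coeff F (a ·ₚ p) k  ≈⟨ coeff-· a p k ⟩
    a * coeff F p k     ≈⟨ *-congˡ (p≈q k) ⟩
    a * coeff F q k     ≈⟨ coeff-· a q k ⟨
    coeff F (a ·ₚ q) k  ∎
    where open SetoidReasoning setoid

  ·-congʳ : ∀ {a b} p → a ≈ b → a ·ₚ p ≈ₚ b ·ₚ p
  ·-congʳ {a} {b} p a≈b k = begin
    coeff F (a ·ₚ p) k  ≈⟨ coeff-· a p k ⟩
    a * coeff F p k     ≈⟨ *-congʳ a≈b ⟩
    b * coeff F p k     ≈⟨ coeff-· b p k ⟨
    coeff F (b ·ₚ p) k  ∎
    where open SetoidReasoning setoid

  ·-assoc : ∀ a b p → (a * b) ·ₚ p ≈ₚ a ·ₚ b ·ₚ p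
  ·-assoc a b p k = begin
    coeff F ((a * b) ·ₚ p) k    ≈⟨ coeff-· (a * b) p k ⟩
    (a * b) * coeff F p k       ≈⟨ *-assoc a b _ ⟩
    a * (b * coeff F p k)       ≈⟨ *-congˡ (coeff-· b p k) ⟨
    a * coeff F (b ·ₚ p) k      ≈⟨ coeff-· a (b ·ₚ p) k ⟨
    coeff F (a ·ₚ b ·ₚ p) k     ∎
    where open SetoidReasoning setoid

  ·-identityˡ : ∀ p → 1# ·ₚ p ≈ₚ p
  ·-identityˡ p k = trans (coeff-· 1# p k) (*-identityˡ _)

  p⊕⊖𝓔p≈p : ∀ p → coeff F p 0 ≈ 0# → p ⊕ₚ ⊖ₚ 𝓔 F p ≈ₚ p
  p⊕⊖𝓔p≈p p p₀≈0 k = begin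
    coeff F (p ⊕ₚ ⊖ₚ 𝓔 F p) k             ≈⟨ coeff-⊕ p (⊖ₚ 𝓔 F p) k ⟩
    coeff F p k +ᴷ coeff F (⊖ₚ 𝓔 F p) k   ≈⟨ +-congˡ (trans (coeff-⊖ (𝓔 F p) k) (-𝓔≈0 k)) ⟩
    coeff F p k +ᴷ 0#                     ≈⟨ +-identityʳ _ ⟩
    coeff F p k                           ∎
    where
    open SetoidReasoning setoid
    -𝓔≈0 : ∀ k → - coeff F (𝓔 F p) k ≈ 0#
    -𝓔≈0 zero    = trans (-‿cong p₀≈0) -0#≈0#
    -𝓔≈0 (suc k) = -0#≈0#

  fromℕ≡×1# : ∀ n → fromℕ F n ≡ n ×ᴷ 1#
  fromℕ≡×1# zero    = ≡.refl
  fromℕ≡×1# (suc n) = ≡.cong (1# +ᴷ_) (fromℕ≡×1# n)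

  fromℕ-homo-* : ∀ m n → fromℕ F (m ℕ.* n) ≈ fromℕ F m * fromℕ F n
  fromℕ-homo-* m n
    rewrite fromℕ≡×1# (m ℕ.* n) | fromℕ≡×1# m | fromℕ≡×1# n = ×1-homo-* m n

  ^-cong : ∀ {T} → IsLinear F T → ∀ n {p q} → p ≈ₚ q → _^_ F T n p ≈ₚ _^_ F T n q
  ^-cong T-linear zero    p≈q = p≈q
  ^-cong T-linear (suc n) p≈q = IsLinear.cong T-linear (^-cong T-linear n p≈q)

module Sigma {c ℓ : Level} (F : Field c ℓ) {Q S : Op F} (σ : IsSigma F Q S) where
  open Field F using (_≈_; 0#)
  open Polynomials F using (_≈ₚ_; _⊕ₚ_; ⊖ₚ_; ≈ₚ-setoid; p⊕⊖𝓔p≈p)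
  open SetoidReasoning ≈ₚ-setoid
  open IsSigma σ using (leftInv)

  leftInv-vanishing : ∀ p → coeff F p 0 ≈ 0# → S (Q p) ≈ₚ p
  leftInv-vanishing p p₀≈0 = begin
    S (Q p)                       ≈⟨ leftInv p ⟩
    p ⊕ₚ ⊖ₚ 𝓔 F p                 ≈⟨ p⊕⊖𝓔p≈p p p₀≈0 ⟩
    p                             ∎

risingFrom-0≡! : ∀ {c ℓ} (F : Field c ℓ) n → risingFrom F 0 n ≡ n !
risingFrom-0≡! F zero    = ≡.refl
risingFrom-0≡! F (suc n) = ≡.trans (≡.cong (ℕ._* suc n) (risingFrom-0≡! F n)) (ℕ.*-comm (n !) (suc n))

module BasicSequence {c ℓ : Level} (F : Field c ℓ) {Q S : Op F} {φ : ℕ → Poly F}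
                     (β : IsBasicSequence F Q φ) (σ : IsSigma F Q S) where
  open Field F using (1#; _*_; *-comm; +-identityʳ; trans)
  open Polynomials F
  open Sigma F σ using (leftInv-vanishing)
  open SetoidReasoning ≈ₚ-setoid
  open IsBasicSequence β using (zeroth; atZero; lowers)
  open IsLinear (IsSigma.linear σ) using (homog) renaming (cong to S-cong)

  S^_ : ℕ → Op F
  S^ n = _^_ F S n

  S-raises : ∀ n → fromℕ F (suc n) ·ₚ S (φ n) ≈ₚ φ (suc n)
  S-raises n = begin
    fromℕ F (suc n) ·ₚ S (φ n)    ≈⟨ homog (fromℕ F (suc n)) (φ n) ⟨
    S (fromℕ F (suc n) ·ₚ φ n)    ≈⟨ S-cong (lowers n) ⟨
    S (Q (φ (suc n)))             ≈⟨ leftInv-vanishing (φ (suc n)) (atZero n) ⟩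
    φ (suc n)                     ∎

  S^-raises : ∀ m p → fromℕ F (risingFrom F m p) ·ₚ (S^ p) (φ m) ≈ₚ φ (m + p)
  S^-raises m zero = begin
    fromℕ F 1 ·ₚ φ m     ≈⟨ ·-congʳ (φ m) (+-identityʳ 1#) ⟩
    1# ·ₚ φ m            ≈⟨ ·-identityˡ (φ m) ⟩
    φ m                  ≡⟨ ≡.cong φ (ℕ.+-identityʳ m) ⟨
    φ (m + 0)            ∎
  S^-raises m (suc p) = begin
    fromℕ F (risingFrom F m p ℕ.* (m + suc p)) ·ₚ S U
      ≈⟨ ·-congʳ (S U) (trans (fromℕ-homo-* (risingFrom F m p) (m + suc p)) (*-comm r b)) ⟩
    (b * r) ·ₚ S U                          ≈⟨ ·-assoc b r (S U) ⟩
    b ·ₚ r ·ₚ S U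
      ≈⟨ ·-congˡ b {S (r ·ₚ U)} {r ·ₚ S U} (homog r U) ⟨
    b ·ₚ S (r ·ₚ U)
      ≈⟨ ·-congˡ b {S (r ·ₚ U)} {S (φ (m + p))} (S-cong {r ·ₚ U} {φ (m + p)} (S^-raises m p)) ⟩
    b ·ₚ S (φ (m + p))                      ≡⟨ ≡.cong (λ j → fromℕ F j ·ₚ S (φ (m + p))) (ℕ.+-suc m p) ⟩
    fromℕ F (suc (m + p)) ·ₚ S (φ (m + p))  ≈⟨ S-raises (m + p) ⟩
    φ (suc (m + p))                         ≡⟨ ≡.cong φ (ℕ.+-suc m p) ⟨
    φ (m + suc p)                           ∎
    where
    U = (S^ p) (φ m)
    r = fromℕ F (risingFrom F m p)
    b = fromℕ F (m + suc p)

  φ≈n!·Sⁿ1 : ∀ n → φ n ≈ₚ fromℕ F (n !) ·ₚ (S^ n) (onePoly F)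
  φ≈n!·Sⁿ1 n = begin
    φ n
      ≈⟨ S^-raises 0 n ⟨
    fromℕ F (risingFrom F 0 n) ·ₚ (S^ n) (φ 0)
      ≡⟨ ≡.cong (λ j → fromℕ F j ·ₚ (S^ n) (φ 0)) (risingFrom-0≡! F n) ⟩
    fromℕ F (n !) ·ₚ (S^ n) (φ 0)
      ≈⟨ ·-congˡ (fromℕ F (n !)) {(S^ n) (φ 0)} {(S^ n) (onePoly F)}
                 (^-cong (IsSigma.linear σ) n {φ 0} {onePoly F} zeroth) ⟩
    fromℕ F (n !) ·ₚ (S^ n) (onePoly F)
      ∎

mainTheorem10 : ∀ {c ℓ : Level} (F : Field c ℓ) → CharZero F →
    (Q : Op F) → IsDelta F Q → (φ : ℕ → Poly F) → IsBasicSequence F Q φ →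
    (S : Op F) → IsSigma F Q S →
    (∀ n p → _≈P_ F (_·_ F (fromℕ F (risingFrom F (suc n) (suc p))) ((_^_ F S (suc p)) (φ (suc n)))) (φ (suc n + suc p)))
    × (∀ n → _≈P_ F (φ n) (_·_ F (fromℕ F (n !)) ((_^_ F S n) (onePoly F))))
mainTheorem10 F _ Q _ φ β S σ = (λ n p → S^-raises (suc n) (suc p)) , φ≈n!·Sⁿ1
  where open BasicSequence F β σ
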